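{- Let $\mathbf A$ be a Stonean residuated lattice. A lattice filter $F$ of $\mathbf A$ is good (i.e. $\neg\neg x\in F$ implies $x\in F$) if and only if $F$ contains every dense element of $\mathbf A$.
   Context: A bounded commutative residuated lattice is $(A,\vee,\wedge,\cdot,\to,0,1)$ with $(A,\vee,\wedge)$ a lattice, $(A,\cdot,1)$ a commutative monoid, $ab\le c$ iff $a\le b\to c$, $1$ greatest, $0$ least; $\neg x:=x\to0$. It is Stonean if it satisfies $\neg x\vee\neg\neg x=1$. An element $x$ is dense if $\neg x=0$. -}

module Defs where

open import Level using (Level; _⊔_; suc)
open import Relation.Binary.PropositionalEquality using (_≡_)
open import Data.Product using (_×_; ∃)

-- A bounded commutative residuated lattice (A, ∨, ∧, ·, →, 0, 1),
-- with equality taken to be propositional equality on the carrier.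
record BCRL (a : Level) : Set (suc a) where
  infixr 6 _∨_
  infixr 7 _∧_
  infixl 8 _·_
  infixr 5 _⇒_
  infix 4 _≤_
  field
    Carrier : Set a
    _∨_ _∧_ _·_ _⇒_ : Carrier → Carrier → Carrier
    ⊥ ⊤ : Carrier
    ∨-comm : ∀ x y → x ∨ y ≡ y ∨ x
    ∧-comm : ∀ x y → x ∧ y ≡ y ∧ x
    ∨-assoc : ∀ x y z → (x ∨ y) ∨ z ≡ x ∨ (y ∨ z)
    ∧-assoc : ∀ x y z → (x ∧ y) ∧ z ≡ x ∧ (y ∧ z)
    ∨-absorbs-∧ : ∀ x y → x ∨ (x ∧ y) ≡ x
    ∧-absorbs-∨ : ∀ x y → x ∧ (x ∨ y) ≡ x
    ·-comm : ∀ x y → x · y ≡ y · x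
    ·-assoc : ∀ x y z → (x · y) · z ≡ x · (y · z)
    ·-identityʳ : ∀ x → x · ⊤ ≡ x

  _≤_ : Carrier → Carrier → Set a
  x ≤ y = x ∧ y ≡ x

  field
    residuated-to : ∀ {x y z} → x · y ≤ z → x ≤ y ⇒ z
    residuated-from : ∀ {x y z} → x ≤ y ⇒ z → x · y ≤ z
    ⊤-greatest : ∀ x → x ≤ ⊤
    ⊥-least : ∀ x → ⊥ ≤ x

  ¬_ : Carrier → Carrier
  ¬ x = x ⇒ ⊥

  Dense : Carrier → Set a
  Dense x = ¬ x ≡ ⊥

Stonean : ∀ {a} → BCRL a → Set a
Stonean A = ∀ x → (¬ x) ∨ (¬ (¬ x)) ≡ ⊤
  where open BCRL A

record IsLatticeFilter {a ℓ} (A : BCRL a) (F : BCRL.Carrier A → Set ℓ) : Set (a ⊔ ℓ) where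
  open BCRL A
  field
    nonempty : ∃ F
    up-closed : ∀ {x y} → x ≤ y → F x → F y
    ∧-closed : ∀ {x y} → F x → F y → F (x ∧ y)

IsGood : ∀ {a ℓ} (A : BCRL a) → (BCRL.Carrier A → Set ℓ) → Set (a ⊔ ℓ)
IsGood A F = ∀ x → F (¬ (¬ x)) → F x
  where open BCRL A

ContainsDense : ∀ {a ℓ} (A : BCRL a) → (BCRL.Carrier A → Set ℓ) → Set (a ⊔ ℓ)
ContainsDense A F = ∀ x → Dense x → F x
  where open BCRL A

-- By residuation, u ∨ v = 1 forces u ∧ v ≤ u · v: write u ∧ v = (u ∧ v) · (u ∨ v) and
-- distribute. In a Stonean lattice this makes ¬x ∧ ¬¬x = 0, whence ¬(x ∨ ¬x) = 0, and it
-- makes ¬¬x ∧ (x ∨ ¬x) ≤ ¬¬x · (x ∨ ¬x) ≤ x. So a filter containing the dense elements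
-- contains x as soon as it contains ¬¬x. Conversely, a good filter contains every dense x,
-- since then ¬¬x = ¬0 = 1.
module Submission where

open import Defs
open import Function.Bundles using (_⇔_; mk⇔)
open import Data.Product using (_,_)
open import Relation.Binary.PropositionalEquality
  using (_≡_; refl; sym; trans; cong; cong₂; subst; isEquivalence)
open import Relation.Binary.Bundles using (Poset)
open import Relation.Binary.Structures using (IsPartialOrder)
open import Algebra.Lattice.Bundles using (Lattice)
import Algebra.Lattice.Properties.Lattice as LatticeProperties
import Relation.Binary.Lattice as OrderLattice
import Relation.Binary.Reasoning.PartialOrder as PosetReasoning

module BCRLProperties {a} (A : BCRL a) where
  open BCRL A

  lattice : Lattice a a
  lattice = record
    { Carrier = Carrier
    ; _≈_ = _≡_
    ; _∨_ = _∨_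
    ; _∧_ = _∧_
    ; isLattice = record
      { isEquivalence = isEquivalence
      ; ∨-comm = ∨-comm
      ; ∨-assoc = ∨-assoc
      ; ∨-cong = cong₂ _∨_
      ; ∧-comm = ∧-comm
      ; ∧-assoc = ∧-assoc
      ; ∧-cong = cong₂ _∧_
      ; absorptive = ∨-absorbs-∧ , ∧-absorbs-∨
      }
    }

  -- The library orders a lattice by x ≈ x ∧ y, the symmetric form of _≤_.
  private
    module Ordered = OrderLattice.Lattice (LatticeProperties.∨-∧-orderTheoreticLattice lattice)

  ≤-isPartialOrder : IsPartialOrder _≡_ _≤_
  ≤-isPartialOrder = record
    { isPreorder = record
      { isEquivalence = isEquivalence
      ; reflexive = λ { refl → sym Ordered.refl }
      ; trans = λ p q → sym (Ordered.trans (sym p) (sym q))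
      }
    ; antisym = λ p q → Ordered.antisym (sym p) (sym q)
    }

  ≤-poset : Poset a a a
  ≤-poset = record { isPartialOrder = ≤-isPartialOrder }

  open Poset ≤-poset public using ()
    renaming (refl to ≤-refl; reflexive to ≤-reflexive; trans to ≤-trans; antisym to ≤-antisym)
  module ≤-Reasoning = PosetReasoning ≤-poset

  x∧y≤x : ∀ x y → x ∧ y ≤ x
  x∧y≤x x y = sym (Ordered.x∧y≤x x y)

  x∧y≤y : ∀ x y → x ∧ y ≤ y
  x∧y≤y x y = sym (Ordered.x∧y≤y x y)

  ∧-greatest : ∀ {x y z} → x ≤ y → x ≤ z → x ≤ y ∧ z
  ∧-greatest p q = sym (Ordered.∧-greatest (sym p) (sym q))

  x≤x∨y : ∀ x y → x ≤ x ∨ y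
  x≤x∨y x y = sym (Ordered.x≤x∨y x y)

  y≤x∨y : ∀ x y → y ≤ x ∨ y
  y≤x∨y x y = sym (Ordered.y≤x∨y x y)

  ∨-least : ∀ {x y z} → x ≤ z → y ≤ z → x ∨ y ≤ z
  ∨-least p q = sym (Ordered.∨-least (sym p) (sym q))

  ⊤≤⇒≡⊤ : ∀ {x} → ⊤ ≤ x → x ≡ ⊤
  ⊤≤⇒≡⊤ {x} p = ≤-antisym (⊤-greatest x) p

  ∨≡⊤-monoʳ : ∀ {u v w} → u ∨ v ≡ ⊤ → v ≤ w → u ∨ w ≡ ⊤
  ∨≡⊤-monoʳ {u} {v} {w} uv≡⊤ v≤w = ⊤≤⇒≡⊤ (begin
    ⊤      ≡⟨ uv≡⊤ ⟨
    u ∨ v  ≤⟨ ∨-least (x≤x∨y u w) (≤-trans v≤w (y≤x∨y u w)) ⟩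
    u ∨ w  ∎)
    where open ≤-Reasoning

  ·-monoˡ-≤ : ∀ {x y} z → x ≤ y → x · z ≤ y · z
  ·-monoˡ-≤ z x≤y = residuated-from (≤-trans x≤y (residuated-to ≤-refl))

  ·-monoʳ-≤ : ∀ x {y z} → y ≤ z → x · y ≤ x · z
  ·-monoʳ-≤ x {y} {z} y≤z = begin
    x · y  ≡⟨ ·-comm x y ⟩
    y · x  ≤⟨ ·-monoˡ-≤ x y≤z ⟩
    z · x  ≡⟨ ·-comm z x ⟩
    x · z  ∎
    where open ≤-Reasoning

  ·-distribʳ-∨ : ∀ x y z → (x ∨ y) · z ≤ x · z ∨ y · z
  ·-distribʳ-∨ x y z =
    residuated-from (∨-least (residuated-to (x≤x∨y _ _)) (residuated-to (y≤x∨y _ _)))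

  ·-distribˡ-∨ : ∀ x y z → x · (y ∨ z) ≤ x · y ∨ x · z
  ·-distribˡ-∨ x y z = begin
    x · (y ∨ z)    ≡⟨ ·-comm x (y ∨ z) ⟩
    (y ∨ z) · x    ≤⟨ ·-distribʳ-∨ y z x ⟩
    y · x ∨ z · x  ≡⟨ cong₂ _∨_ (·-comm y x) (·-comm z x) ⟩
    x · y ∨ x · z  ∎
    where open ≤-Reasoning

  x·y≤x : ∀ x y → x · y ≤ x
  x·y≤x x y = begin
    x · y  ≤⟨ ·-monoʳ-≤ x (⊤-greatest y) ⟩
    x · ⊤  ≡⟨ ·-identityʳ x ⟩
    x      ∎
    where open ≤-Reasoning

  ¬x·x≤⊥ : ∀ x → ¬ x · x ≤ ⊥
  ¬x·x≤⊥ x = residuated-from ≤-refl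

  x·¬x≤⊥ : ∀ x → x · ¬ x ≤ ⊥
  x·¬x≤⊥ x = ≤-trans (≤-reflexive (·-comm x (¬ x))) (¬x·x≤⊥ x)

  ¬-antitone : ∀ {x y} → x ≤ y → ¬ y ≤ ¬ x
  ¬-antitone {x} {y} x≤y = residuated-to (≤-trans (·-monoʳ-≤ (¬ y) x≤y) (¬x·x≤⊥ y))

  ¬⊥≡⊤ : ¬ ⊥ ≡ ⊤
  ¬⊥≡⊤ = ⊤≤⇒≡⊤ (residuated-to (≤-reflexive (trans (·-comm ⊤ ⊥) (·-identityʳ ⊥))))

  ∨≡⊤⇒∧≤· : ∀ {u v} → u ∨ v ≡ ⊤ → u ∧ v ≤ u · v
  ∨≡⊤⇒∧≤· {u} {v} uv≡⊤ = begin
    u ∧ v                  ≡⟨ ·-identityʳ (u ∧ v) ⟨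
    (u ∧ v) · ⊤            ≡⟨ cong ((u ∧ v) ·_) uv≡⊤ ⟨
    (u ∧ v) · (u ∨ v)      ≤⟨ ·-distribˡ-∨ (u ∧ v) u v ⟩
    (u ∧ v) · u ∨ (u ∧ v) · v
      ≤⟨ ∨-least (≤-trans (·-monoˡ-≤ u (x∧y≤y u v)) (≤-reflexive (·-comm v u)))
                 (·-monoˡ-≤ v (x∧y≤x u v)) ⟩
    u · v                  ∎
    where open ≤-Reasoning

module StoneanProperties {a} (A : BCRL a) (stonean : Stonean A) where
  open BCRL A
  open BCRLProperties A

  ¬x∧¬¬x≤⊥ : ∀ x → ¬ x ∧ ¬ ¬ x ≤ ⊥
  ¬x∧¬¬x≤⊥ x = ≤-trans (∨≡⊤⇒∧≤· (stonean x)) (x·¬x≤⊥ (¬ x))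

  x∨¬x-dense : ∀ x → Dense (x ∨ ¬ x)
  x∨¬x-dense x = ≤-antisym ¬[x∨¬x]≤⊥ (⊥-least _)
    where
    ¬[x∨¬x]≤⊥ : ¬ (x ∨ ¬ x) ≤ ⊥
    ¬[x∨¬x]≤⊥ = ≤-trans
      (∧-greatest (¬-antitone (x≤x∨y x (¬ x))) (¬-antitone (y≤x∨y x (¬ x))))
      (¬x∧¬¬x≤⊥ x)

  ¬¬x∧[x∨¬x]≤x : ∀ x → ¬ ¬ x ∧ (x ∨ ¬ x) ≤ x
  ¬¬x∧[x∨¬x]≤x x = begin
    ¬ ¬ x ∧ (x ∨ ¬ x)          ≤⟨ ∨≡⊤⇒∧≤· ¬¬x∨x∨¬x≡⊤ ⟩
    ¬ ¬ x · (x ∨ ¬ x)          ≤⟨ ·-distribˡ-∨ (¬ ¬ x) x (¬ x) ⟩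
    ¬ ¬ x · x ∨ ¬ ¬ x · ¬ x    ≤⟨ ∨-least ¬¬x·x≤x (≤-trans (¬x·x≤⊥ (¬ x)) (⊥-least x)) ⟩
    x                          ∎
    where
    open ≤-Reasoning
    ¬¬x∨x∨¬x≡⊤ : ¬ ¬ x ∨ (x ∨ ¬ x) ≡ ⊤
    ¬¬x∨x∨¬x≡⊤ = ∨≡⊤-monoʳ (trans (∨-comm (¬ ¬ x) (¬ x)) (stonean x)) (y≤x∨y x (¬ x))
    ¬¬x·x≤x : ¬ ¬ x · x ≤ x
    ¬¬x·x≤x = ≤-trans (≤-reflexive (·-comm (¬ ¬ x) x)) (x·y≤x x (¬ ¬ x))

module FilterProperties {a ℓ} (A : BCRL a) {F : BCRL.Carrier A → Set ℓ}
                        (isFilter : IsLatticeFilter A F) where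
  open BCRL A
  open BCRLProperties A
  open IsLatticeFilter isFilter

  ⊤∈F : F ⊤
  ⊤∈F = let (x , x∈F) = nonempty in up-closed (⊤-greatest x) x∈F

  good⇒containsDense : IsGood A F → ContainsDense A F
  good⇒containsDense good x ¬x≡⊥ = good x (subst F (sym ¬¬x≡⊤) ⊤∈F)
    where
    ¬¬x≡⊤ : ¬ ¬ x ≡ ⊤
    ¬¬x≡⊤ = trans (cong ¬_ ¬x≡⊥) ¬⊥≡⊤

  containsDense⇒good : Stonean A → ContainsDense A F → IsGood A F
  containsDense⇒good stonean containsDense x ¬¬x∈F =
    up-closed (¬¬x∧[x∨¬x]≤x x) (∧-closed ¬¬x∈F (containsDense (x ∨ ¬ x) (x∨¬x-dense x)))
    where open StoneanProperties A stonean

lemma3p9 : ∀ {a ℓ} (A : BCRL a) → Stonean A → (F : BCRL.Carrier A → Set ℓ) → IsLatticeFilter A F → (IsGood A F ⇔ ContainsDense A F)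
lemma3p9 A stonean F isFilter = mk⇔ good⇒containsDense (containsDense⇒good stonean)
  where open FilterProperties A isFilter
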